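{- Let $X=\{a_1,\dots,a_{3n}\}$ be a set of distinct natural numbers with $\sum_i a_i=nB$ and $B/4<a_i<B/2$ for all $i$, and let $m$, $P_I$ and $IG(X)$ be as defined in the context. If $(y_1,y_2,\dots,y_{2m+1})$ is a burning sequence of $IG(X)$ of length $2m+1$ (i.e., an optimal burning sequence), then every fire source $y_i$ is a vertex of $P_I$.
   Context: Let $m=\max(X)$, $X'=\{2a_i-1: a_i\in X\}$, $B'=2B-3$, $F'_m=\{1,3,\dots,2m-1\}$, $Y=F'_m\setminus X'$, $k=|Y|=m-3n$. Take paths $Q_1,\dots,Q_n$ each with $B'$ vertices; paths $Q'_1,\dots,Q'_k$ where $Q'_j$ has as many vertices as the $j$-th largest element of $Y$; and paths $T_1,\dots,T_{m+1}$ where $T_j$ has $2(2m+1-j)+1$ vertices. Join them (adding an edge from the last vertex of one to the first vertex of the next) in the order $Q_1,T_1,\dots,Q_n,T_n,Q'_1,T_{n+1},\dots,Q'_k,T_{n+k},T_{n+k+1},\dots,T_{m+1}$ to obtain a path $P_I$ with $(2m+1)^2$ vertices. Then attach to every vertex of each $T_j$ other than its first and last vertex a new pendant vertex. The resulting graph is $IG(X)$. Graph burning on $G$: in each round $t$, first a vertex $x_t$ is chosen as a fire source and becomes burnt, then every vertex adjacent to a vertex burnt by the end of round $t-1$ becomes burnt. A burning sequence $(x_1,\dots,x_k)$ is one with $\bigcup_{i=1}^k N_{k-i}[x_i]=V(G)$, $N_r[x]$ being the set of vertices at distance at most $r$ from $x$. -}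

module Defs where

open import Data.Nat using (ℕ; zero; suc; _+_; _*_; _∸_; _<_; _⊔_; _≟_)
open import Data.Bool using (Bool; true; false)
open import Data.List using (List; []; _∷_; _++_; map; foldr; replicate; filter; applyUpTo; applyDownFrom)
open import Data.List.Membership.DecPropositional _≟_ using (_∉?_)
open import Data.Nat.ListAction using (sum)
open import Data.Fin using (Fin; toℕ)
open import Data.Product using (Σ; ∃; _×_; _,_; proj₁)
open import Data.Sum using (_⊎_; inj₁; inj₂)
open import Data.Empty using (⊥)
open import Relation.Binary.PropositionalEquality using (_≡_)

-- Simple graphs (adjacency given as a relation; we only use symmetric ones)

record Graph : Set₁ where
  field
    Vtx : Set
    Adj : Vtx → Vtx → Set
open Graph public

-- Walk G r x y : there is a walk of length at most r from x to y,
-- i.e. dist(x,y) ≤ r, i.e. y ∈ N_r[x].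
data Walk (G : Graph) : ℕ → Vtx G → Vtx G → Set where
  here : ∀ {r x} → Walk G r x x
  step : ∀ {r x y z} → Adj G x y → Walk G r y z → Walk G (suc r) x z

-- (x_1,...,x_L) is a burning sequence: ⋃_i N_{L-i}[x_i] = V(G).
-- With 0-based index i : Fin L, the radius of the i-th source is L - (i+1).
IsBurningSequence : (G : Graph) (L : ℕ) → (Fin L → Vtx G) → Set
IsBurningSequence G L xs =
  ∀ (v : Vtx G) → ∃ λ (i : Fin L) → Walk G (L ∸ suc (toℕ i)) (xs i) v

maxL : List ℕ → ℕ
maxL = foldr _⊔_ 0

X′ : List ℕ → List ℕ
X′ X = map (λ a → 2 * a ∸ 1) X

oddsDesc : ℕ → List ℕ
oddsDesc m = applyDownFrom (λ i → 2 * i + 1) m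

-- Y = F'_m \ X', listed in decreasing order (so its j-th entry is the
-- j-th largest element of Y)
Yset : List ℕ → List ℕ
Yset X = filter (_∉? X′ X) (oddsDesc (maxL X))

tLen : ℕ → ℕ → ℕ
tLen m j = 2 * (2 * m + 1 ∸ j) + 1

-- Blocks of P_I in order; a block is (isT , number of vertices).
-- interleave m j [q_1,...,q_r] = q_1, T_j, q_2, T_{j+1}, ..., q_r, T_{j+r-1}
interleave : ℕ → ℕ → List ℕ → List (Bool × ℕ)
interleave m j []       = []
interleave m j (q ∷ qs) = (false , q) ∷ (true , tLen m j) ∷ interleave m (suc j) qs

-- Q_1,T_1,...,Q_n,T_n,Q'_1,T_{n+1},...,Q'_k,T_{n+k},T_{n+k+1},...,T_{m+1}
-- where Q_i has B' = 2B-3 vertices and k = |Y|.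
blocks : ℕ → ℕ → List ℕ → List (Bool × ℕ)
blocks n B X =
  interleave m 1 (replicate n (2 * B ∸ 3) ++ Y)
  ++ applyUpTo (λ i → (true , tLen m (n + k + 1 + i))) (m + 1 ∸ (n + k))
  where
    m = maxL X
    Y = Yset X
    k = Data.List.length Y

pathLen : List (Bool × ℕ) → ℕ
pathLen bs = sum (map Data.Product.proj₂ bs)

-- TInterior s bs i : path vertex i (0-based position along P_I) is a vertex of
-- some T_j other than its first and last vertex (blocks start at offset s).
TInterior : ℕ → List (Bool × ℕ) → ℕ → Set
TInterior s []              i = ⊥
TInterior s ((b , ℓ) ∷ bs) i =
  (b ≡ true × s < i × suc i < s + ℓ) ⊎ TInterior (s + ℓ) bs i

-- Underlying vertex names: inj₁ i = i-th vertex of P_I,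
-- inj₂ i = the pendant vertex attached to the i-th vertex of P_I.
IsIGVertex : List (Bool × ℕ) → ℕ ⊎ ℕ → Set
IsIGVertex bs (inj₁ i) = i < pathLen bs
IsIGVertex bs (inj₂ i) = TInterior 0 bs i

IGAdj : List (Bool × ℕ) → ℕ ⊎ ℕ → ℕ ⊎ ℕ → Set
IGAdj bs (inj₁ i) (inj₁ j) = suc i ≡ j ⊎ suc j ≡ i
IGAdj bs (inj₁ i) (inj₂ j) = i ≡ j
IGAdj bs (inj₂ i) (inj₁ j) = i ≡ j
IGAdj bs (inj₂ i) (inj₂ j) = ⊥

IGfromBlocks : List (Bool × ℕ) → Graph
IGfromBlocks bs = record
  { Vtx = Σ (ℕ ⊎ ℕ) (IsIGVertex bs)
  ; Adj = λ u v → IGAdj bs (proj₁ u) (proj₁ v)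
  }

IG : ℕ → ℕ → List ℕ → Graph
IG n B X = IGfromBlocks (blocks n B X)

OnPI : ∀ {bs} → Σ (ℕ ⊎ ℕ) (IsIGVertex bs) → Set
OnPI v = ∃ λ j → proj₁ v ≡ inj₁ j

module Submission where

open import Defs
open import Data.Bool using (Bool; true; false; T)
open import Data.Empty using (⊥-elim)
open import Data.Fin using (Fin; toℕ) renaming (zero to fzero; suc to fsuc)
open import Data.List using (List; []; _∷_; _++_; [_]; length; map; replicate; filter; applyUpTo)
open import Data.List.Properties using (map-applyUpTo; applyUpTo-∷ʳ; map-++; length-++; length-replicate)
open import Data.List.Relation.Unary.All using (All; []; _∷_) renaming (map to all-map)
open import Data.List.Relation.Unary.All.Properties using (all-filter)
open import Data.List.Relation.Unary.AllPairs using ([]; _∷_)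
open import Data.List.Relation.Unary.Any using (here; there)
open import Data.List.Relation.Unary.Unique.Propositional using (Unique)
open import Data.List.Relation.Unary.Unique.Propositional.Properties using (filter⁺)
open import Data.Nat
open import Data.List.Membership.DecPropositional _≟_ using (_∈_; _∈?_)
open import Data.Nat.ListAction using (sum)
open import Data.Nat.ListAction.Properties using (sum-++)
open import Data.Nat.Properties
open import Data.Nat.Tactic.RingSolver using (solve-∀)
open import Algebra.Properties.CommutativeMonoid.Sum +-0-commutativeMonoid
  using (sum-syntax; ∑-distrib-+)
open import Data.Product using (Σ; ∃; _×_; _,_; proj₁; proj₂)
open import Data.Sum using (_⊎_; inj₁; inj₂)
open import Function using (_∘_)
open import Relation.Binary.PropositionalEquality using (_≡_; refl; sym; trans; cong; cong₂; module ≡-Reasoning)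
open import Relation.Nullary using (¬_; ¬?; does)
open import Relation.Unary using (Pred; Decidable)

-- Write N = |P_I| and L = 2m+1.  In a burning sequence the
-- i-th source has radius r_i = L-1-i, so it reaches at most 2r_i+1
-- vertices of the path P_I, and at most 2r_i if it is a pendant vertex
-- (it then needs one step just to enter the path).  The sources must
-- reach all N path vertices, so
--     N + #(pendant sources) ≤ ∑ (2 r_i + 1) = L².
-- Hence it suffices that N ≥ L², which holds because the blocks Q_i, Q'_j
-- contain at least m² vertices (the odd numbers below 2m are covered by
-- X' and Y, and ∑X' = n(2B-3)) and T_1,…,T_{m+1} contain (2m+1)² - m².

-- Counting elements of initial segments of ℕ

indicator : Bool → ℕ
indicator true  = 1
indicator false = 0

count : (ℕ → Bool) → ℕ → ℕ
count f zero    = 0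
count f (suc N) = count f N + indicator (f N)

count-window : ∀ f lo hi → (∀ j → T (f j) → lo ≤ j × j < hi) →
  ∀ N → count f N ≤ (N ⊓ hi) ∸ lo
count-window f lo hi inside zero = z≤n
count-window f lo hi inside (suc N) with f N | inside N
... | false | _ = begin
    count f N + 0         ≡⟨ +-identityʳ _ ⟩
    count f N             ≤⟨ count-window f lo hi inside N ⟩
    (N ⊓ hi) ∸ lo         ≤⟨ ∸-monoˡ-≤ lo (⊓-monoˡ-≤ hi (n≤1+n N)) ⟩
    (suc N ⊓ hi) ∸ lo     ∎
  where open ≤-Reasoning
... | true | inside-N with inside-N _
...   | lo≤N , N<hi = begin
    count f N + 1         ≤⟨ +-monoˡ-≤ 1 (count-window f lo hi inside N) ⟩
    (N ⊓ hi) ∸ lo + 1     ≡⟨ cong (λ k → k ∸ lo + 1) (m≤n⇒m⊓n≡m (<⇒≤ N<hi)) ⟩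
    N ∸ lo + 1            ≡⟨ sym (+-∸-comm 1 lo≤N) ⟩
    (N + 1) ∸ lo          ≡⟨ cong (_∸ lo) (trans (+-comm N 1) (sym (m≤n⇒m⊓n≡m N<hi))) ⟩
    (suc N ⊓ hi) ∸ lo     ∎
  where open ≤-Reasoning

count-ball : ∀ f p s → (∀ j → T (f j) → ∣ p - j ∣ ≤ s) →
  ∀ N → count f N ≤ suc (2 * s)
count-ball f p s near N = begin
    count f N                       ≤⟨ count-window f (p ∸ s) (suc (p + s)) inside N ⟩
    (N ⊓ suc (p + s)) ∸ (p ∸ s)     ≤⟨ ∸-monoˡ-≤ (p ∸ s) (m⊓n≤n N _) ⟩
    suc (p + s) ∸ (p ∸ s)           ≤⟨ m≤n+o⇒m∸n≤o _ (p ∸ s) width ⟩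
    suc (2 * s)                     ∎
  where
  open ≤-Reasoning
  inside : ∀ j → T (f j) → p ∸ s ≤ j × j < suc (p + s)
  inside j t =
      m≤n+o⇒m∸n≤o p s (≤-trans (m≤n+∣m-n∣ p j) (≤-trans (+-monoʳ-≤ j (near j t)) (≤-reflexive (+-comm j s))))
    , s≤s (≤-trans (m≤n+∣m-n∣ j p) (+-monoʳ-≤ p (≤-trans (≤-reflexive (∣-∣-comm j p)) (near j t))))
  width : suc (p + s) ≤ (p ∸ s) + suc (2 * s)
  width = ≤-trans (s≤s (+-monoˡ-≤ s (m≤n+m∸n p s))) (≤-reflexive (rearrange s (p ∸ s)))
    where
    rearrange : ∀ s q → suc (s + q + s) ≡ q + suc (2 * s)
    rearrange = solve-∀

∑-mono : ∀ {L} (f g : Fin L → ℕ) → (∀ i → f i ≤ g i) → ∑[ i < L ] f i ≤ ∑[ i < L ] g i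
∑-mono {zero}  f g f≤g = z≤n
∑-mono {suc L} f g f≤g = +-mono-≤ (f≤g fzero) (∑-mono (f ∘ fsuc) (g ∘ fsuc) (f≤g ∘ fsuc))

term≤∑ : ∀ {L} (f : Fin L → ℕ) i → f i ≤ ∑[ k < L ] f k
term≤∑ f fzero    = m≤m+n (f fzero) _
term≤∑ f (fsuc i) = ≤-trans (term≤∑ (f ∘ fsuc) i) (m≤n+m _ (f fzero))

∑-odd-radii : ∀ L → ∑[ i < L ] suc (2 * (L ∸ suc (toℕ i))) ≡ L * L
∑-odd-radii zero    = refl
∑-odd-radii (suc L) = trans (cong (suc (2 * L) +_) (∑-odd-radii L)) (square-step L)
  where
  square-step : ∀ L → suc (2 * L) + L * L ≡ suc L * suc L
  square-step = solve-∀

cover-bound : ∀ {L} (F : Fin L → ℕ → Bool) N →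
  (∀ j → j < N → ∃ λ i → T (F i j)) → N ≤ ∑[ i < L ] count (F i) N
cover-bound F zero    covered = z≤n
cover-bound F (suc N) covered = begin
    suc N                                                  ≡⟨ +-comm 1 N ⟩
    N + 1                                                  ≤⟨ +-mono-≤ (cover-bound F N (λ j j<N → covered j (m≤n⇒m≤1+n j<N))) hit ⟩
    ∑[ i < _ ] count (F i) N + ∑[ i < _ ] indicator (F i N) ≡⟨ sym (∑-distrib-+ (λ i → count (F i) N) (λ i → indicator (F i N))) ⟩
    ∑[ i < _ ] count (F i) (suc N)                         ∎
  where
  open ≤-Reasoning
  T⇒indicator : ∀ {b} → T b → 1 ≤ indicator b
  T⇒indicator {true} _ = ≤-refl
  hit : 1 ≤ ∑[ i < _ ] indicator (F i N)
  hit with covered N ≤-refl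
  ... | i , t = ≤-trans (T⇒indicator t) (term≤∑ (λ i → indicator (F i N)) i)

-- Distances in IGfromBlocks

-- A vertex name lies over the path position 'position' at 'height' 0
-- (path vertex) or 1 (pendant vertex).
position : ℕ ⊎ ℕ → ℕ
position (inj₁ p) = p
position (inj₂ p) = p

height : ℕ ⊎ ℕ → ℕ
height (inj₁ _) = 0
height (inj₂ _) = 1

height≤1 : ∀ u → height u ≤ 1
height≤1 (inj₁ _) = z≤n
height≤1 (inj₂ _) = ≤-refl

∣n-1+n∣≡1 : ∀ n → ∣ n - suc n ∣ ≡ 1
∣n-1+n∣≡1 zero    = refl
∣n-1+n∣≡1 (suc n) = ∣n-1+n∣≡1 n

path-neighbour : ∀ i k j → suc i ≡ k ⊎ suc k ≡ i → ∣ i - j ∣ ≤ suc ∣ k - j ∣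
path-neighbour i .(suc i) j (inj₁ refl) =
  ≤-trans (∣-∣-triangle i (suc i) j) (≤-reflexive (cong (_+ ∣ suc i - j ∣) (∣n-1+n∣≡1 i)))
path-neighbour .(suc k) k j (inj₂ refl) =
  ≤-trans (∣-∣-triangle (suc k) k j)
          (≤-reflexive (cong (_+ ∣ k - j ∣) (trans (∣-∣-comm (suc k) k) (∣n-1+n∣≡1 k))))

edge-step : ∀ {bs} u v j → IGAdj bs u v →
  height u + ∣ position u - j ∣ ≤ suc (height v + ∣ position v - j ∣)
edge-step (inj₁ i) (inj₁ k) j adj  = path-neighbour i k j adj
edge-step (inj₁ i) (inj₂ .i) j refl = m≤n+m ∣ i - j ∣ 2
edge-step (inj₂ i) (inj₁ .i) j refl = ≤-refl

walk-reach : ∀ {bs r x y j} → Walk (IGfromBlocks bs) r x y → proj₁ y ≡ inj₁ j →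
  height (proj₁ x) + ∣ position (proj₁ x) - j ∣ ≤ r
walk-reach {x = inj₁ j , _} here refl = ≤-trans (≤-reflexive (∣n-n∣≡0 j)) z≤n
walk-reach {x = inj₂ _ , _} here ()
walk-reach {bs} {x = x} {j = j} (step {y = y} adj w) e =
  ≤-trans (edge-step {bs} (proj₁ x) (proj₁ y) j adj) (s≤s (walk-reach w e))

reach-count : ∀ f p d r → d ≤ 1 → (∀ j → T (f j) → d + ∣ p - j ∣ ≤ r) →
  ∀ N → d + count f N ≤ suc (2 * r)
reach-count f p zero    r       _ near N = count-ball f p r near N
reach-count f p (suc zero) zero _ near N =
  ≤-trans (+-monoʳ-≤ 1 (count-window f 0 0 empty N)) (s≤s (m⊓n≤n N 0))
  where
  empty : ∀ j → T (f j) → 0 ≤ j × j < 0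
  empty j t with near j t
  ... | ()
reach-count f p (suc zero) (suc r) _ near N = begin
    suc (count f N)      ≤⟨ s≤s (count-ball f p r (λ j t → s≤s⁻¹ (near j t)) N) ⟩
    suc (suc (2 * r))    ≤⟨ n≤1+n _ ⟩
    suc (2 + 2 * r)      ≡⟨ cong suc (sym (*-suc 2 r)) ⟩
    suc (2 * suc r)      ∎
  where open ≤-Reasoning
reach-count f p (suc (suc d)) r (s≤s ()) near N

-- Pendant sources are impossible on a path with at least L² vertices

-- Counting argument: the sources reach all N path vertices, each reaches
-- at most 2r+1-height of them and ∑(2r+1) = L² ≤ N, so all heights vanish.
no-pendant-sources : ∀ bs L (xs : Fin L → Vtx (IGfromBlocks bs)) →
  IsBurningSequence (IGfromBlocks bs) L xs → L * L ≤ pathLen bs →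
  ∑[ k < L ] height (proj₁ (xs k)) ≤ 0
no-pendant-sources bs L xs burning long = +-cancelʳ-≤ N _ 0 (begin
    ∑[ k < L ] h k + N                              ≤⟨ +-monoʳ-≤ _ (cover-bound reaches N covered) ⟩
    ∑[ k < L ] h k + ∑[ k < L ] count (reaches k) N ≡⟨ sym (∑-distrib-+ h (λ k → count (reaches k) N)) ⟩
    ∑[ k < L ] (h k + count (reaches k) N)          ≤⟨ ∑-mono _ _ bounded ⟩
    ∑[ k < L ] suc (2 * r k)                        ≡⟨ ∑-odd-radii L ⟩
    L * L                                           ≤⟨ long ⟩
    N                                               ∎)
  where
  open ≤-Reasoning
  N = pathLen bs
  r : Fin L → ℕ
  r k = L ∸ suc (toℕ k)
  h : Fin L → ℕ
  h k = height (proj₁ (xs k))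
  reaches : Fin L → ℕ → Bool
  reaches k j = h k + ∣ position (proj₁ (xs k)) - j ∣ ≤ᵇ r k

  covered : ∀ j → j < N → ∃ λ k → T (reaches k j)
  covered j j<N with burning (inj₁ j , j<N)
  ... | k , w = k , ≤⇒≤ᵇ (walk-reach w refl)

  bounded : ∀ k → h k + count (reaches k) N ≤ suc (2 * r k)
  bounded k = reach-count (reaches k) (position (proj₁ (xs k))) (h k) (r k)
    (height≤1 (proj₁ (xs k))) (λ j → ≤ᵇ⇒≤ _ _) N

sources-on-path : ∀ bs L (xs : Fin L → Vtx (IGfromBlocks bs)) →
  IsBurningSequence (IGfromBlocks bs) L xs → L * L ≤ pathLen bs →
  ∀ i → OnPI {bs} (xs i)
sources-on-path bs L xs burning long i
  with proj₁ (xs i)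
     | ≤-trans (term≤∑ (λ k → height (proj₁ (xs k))) i) (no-pendant-sources bs L xs burning long)
... | inj₁ j | _  = j , refl
... | inj₂ _ | ()

applyUpTo-cong : ∀ {f g : ℕ → ℕ} → (∀ i → f i ≡ g i) → ∀ c → applyUpTo f c ≡ applyUpTo g c
applyUpTo-cong f≗g zero    = refl
applyUpTo-cong f≗g (suc c) = cong₂ _∷_ (f≗g 0) (applyUpTo-cong (f≗g ∘ suc) c)

applyUpTo-+ : ∀ {A : Set} (f : ℕ → A) a b →
  applyUpTo f (a + b) ≡ applyUpTo f a ++ applyUpTo (λ i → f (a + i)) b
applyUpTo-+ f zero    b = refl
applyUpTo-+ f (suc a) b = cong (f 0 ∷_) (applyUpTo-+ (f ∘ suc) a b)

sum-applyUpTo-+ : ∀ f a b →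
  sum (applyUpTo f (a + b)) ≡ sum (applyUpTo f a) + sum (applyUpTo (λ i → f (a + i)) b)
sum-applyUpTo-+ f a b = trans (cong sum (applyUpTo-+ f a b)) (sum-++ (applyUpTo f a) _)

sum-applyUpTo-mono : ∀ f {c c′} → c ≤ c′ → sum (applyUpTo f c) ≤ sum (applyUpTo f c′)
sum-applyUpTo-mono f {c} {c′} c≤c′ = begin
    sum (applyUpTo f c)                    ≤⟨ m≤m+n _ _ ⟩
    sum (applyUpTo f c) + _                ≡⟨ sym (sum-applyUpTo-+ f c (c′ ∸ c)) ⟩
    sum (applyUpTo f (c + (c′ ∸ c)))       ≡⟨ cong (sum ∘ applyUpTo f) (m+[n∸m]≡n c≤c′) ⟩
    sum (applyUpTo f c′)                   ∎
  where open ≤-Reasoning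

sum-applyUpTo-suc : ∀ f c → sum (applyUpTo f (suc c)) ≡ sum (applyUpTo f c) + f c
sum-applyUpTo-suc f c = begin
    sum (applyUpTo f (suc c))              ≡⟨ cong sum (sym (applyUpTo-∷ʳ f c)) ⟩
    sum (applyUpTo f c ++ [ f c ])         ≡⟨ sum-++ (applyUpTo f c) [ f c ] ⟩
    sum (applyUpTo f c) + (f c + 0)        ≡⟨ cong (sum (applyUpTo f c) +_) (+-identityʳ (f c)) ⟩
    sum (applyUpTo f c) + f c              ∎
  where open ≡-Reasoning

sum-top-odds : ∀ a c → c ≤ a →
  sum (applyUpTo (λ t → 2 * (a ∸ suc t) + 1) c) + (a ∸ c) * (a ∸ c) ≡ a * a
sum-top-odds a zero    _   = refl
sum-top-odds a (suc c) c<a = begin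
    sum (applyUpTo g (suc c)) + e * e      ≡⟨ cong (_+ e * e) (sum-applyUpTo-suc g c) ⟩
    sum (applyUpTo g c) + g c + e * e      ≡⟨ next-square (sum (applyUpTo g c)) e ⟩
    sum (applyUpTo g c) + suc e * suc e    ≡⟨ cong (λ k → sum (applyUpTo g c) + k * k) (sym (+-∸-assoc 1 c<a)) ⟩
    sum (applyUpTo g c) + (a ∸ c) * (a ∸ c) ≡⟨ sum-top-odds a c (<⇒≤ c<a) ⟩
    a * a                                  ∎
  where
  open ≡-Reasoning
  g : ℕ → ℕ
  g t = 2 * (a ∸ suc t) + 1
  e = a ∸ suc c
  next-square : ∀ s e → s + (2 * e + 1) + e * e ≡ s + suc e * suc e
  next-square = solve-∀

-- The length of P_I

pathLen-++ : ∀ xs ys → pathLen (xs ++ ys) ≡ pathLen xs + pathLen ys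
pathLen-++ xs ys = trans (cong sum (map-++ proj₂ xs ys)) (sum-++ (map proj₂ xs) _)

pathLen-interleave : ∀ m j qs →
  pathLen (interleave m j qs) ≡ sum qs + sum (applyUpTo (λ t → tLen m (j + t)) (length qs))
pathLen-interleave m j []       = refl
pathLen-interleave m j (q ∷ qs) = begin
    q + (tLen m j + pathLen (interleave m (suc j) qs))
      ≡⟨ cong (λ k → q + (tLen m j + k)) (pathLen-interleave m (suc j) qs) ⟩
    q + (tLen m j + (sum qs + sum (applyUpTo (λ t → tLen m (suc j + t)) (length qs))))
      ≡⟨ regroup q (tLen m j) (sum qs) _ ⟩
    q + sum qs + (tLen m j + sum (applyUpTo (λ t → tLen m (suc j + t)) (length qs)))
      ≡⟨ cong₂ (λ u v → q + sum qs + (tLen m u + sum v)) (sym (+-identityʳ j))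
               (applyUpTo-cong (λ t → cong (tLen m) (sym (+-suc j t))) (length qs)) ⟩
    q + sum qs + sum (applyUpTo (λ t → tLen m (j + t)) (suc (length qs)))
      ∎
  where
  open ≡-Reasoning
  regroup : ∀ a b c d → a + (b + (c + d)) ≡ a + c + (b + d)
  regroup = solve-∀

pathLen-Ts : ∀ (g : ℕ → ℕ) c → pathLen (applyUpTo (λ i → (true , g i)) c) ≡ sum (applyUpTo g c)
pathLen-Ts g c = cong sum (map-applyUpTo _ proj₂ c)

pathLen-blocks : ∀ n B X →
  sum (replicate n (2 * B ∸ 3) ++ Yset X) + sum (applyUpTo (λ t → tLen (maxL X) (1 + t)) (maxL X + 1))
    ≤ pathLen (blocks n B X)
pathLen-blocks n B X = begin
    sum qs + sum (applyUpTo f M)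
      ≤⟨ +-monoʳ-≤ (sum qs) (sum-applyUpTo-mono f (m≤n+m∸n M a)) ⟩
    sum qs + sum (applyUpTo f (a + (M ∸ a)))
      ≡⟨ cong (sum qs +_) (sum-applyUpTo-+ f a (M ∸ a)) ⟩
    sum qs + (sum (applyUpTo f a) + sum (applyUpTo (λ i → f (a + i)) (M ∸ a)))
      ≡⟨ sym (+-assoc (sum qs) _ _) ⟩
    sum qs + sum (applyUpTo f a) + sum (applyUpTo (λ i → f (a + i)) (M ∸ a))
      ≡⟨ cong₂ (λ u v → sum qs + sum (applyUpTo f u) + sum v) (sym length-qs)
               (applyUpTo-cong (λ i → cong (tLen m) (sym (shift a i))) (M ∸ a)) ⟩
    sum qs + sum (applyUpTo f (length qs)) + sum (applyUpTo (λ i → tLen m (a + 1 + i)) (M ∸ a))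
      ≡⟨ cong₂ _+_ (sym (pathLen-interleave m 1 qs)) (sym (pathLen-Ts (λ i → tLen m (a + 1 + i)) (M ∸ a))) ⟩
    pathLen (interleave m 1 qs) + pathLen (applyUpTo (λ i → (true , tLen m (a + 1 + i))) (M ∸ a))
      ≡⟨ sym (pathLen-++ (interleave m 1 qs) _) ⟩
    pathLen (blocks n B X) ∎
  where
  open ≤-Reasoning
  m = maxL X
  M = m + 1
  qs = replicate n (2 * B ∸ 3) ++ Yset X
  a = n + length (Yset X)
  f : ℕ → ℕ
  f t = tLen m (1 + t)
  length-qs : length qs ≡ a
  length-qs = trans (length-++ (replicate n (2 * B ∸ 3))) (cong (_+ length (Yset X)) (length-replicate n))
  shift : ∀ a i → a + 1 + i ≡ 1 + (a + i)
  shift = solve-∀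

-- The Q-blocks have at least m² vertices

sum-odds : ∀ m → sum (oddsDesc m) ≡ m * m
sum-odds zero    = refl
sum-odds (suc m) = trans (cong (2 * m + 1 +_) (sum-odds m)) (next-square m)
  where
  next-square : ∀ m → 2 * m + 1 + m * m ≡ suc m * suc m
  next-square = solve-∀

oddsDesc-bound : ∀ m → All (_< 2 * m + 1) (oddsDesc m)
oddsDesc-bound zero    = []
oddsDesc-bound (suc m) = top ∷ all-map (λ y<2m+1 → <-trans y<2m+1 top) (oddsDesc-bound m)
  where
  top : 2 * m + 1 < 2 * suc m + 1
  top = +-monoˡ-< 1 (*-monoʳ-< 2 (n<1+n m))

oddsDesc-unique : ∀ m → Unique (oddsDesc m)
oddsDesc-unique zero    = []
oddsDesc-unique (suc m) =
  all-map (λ y<top top≡y → <-irrefl (sym top≡y) y<top) (oddsDesc-bound m)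
  ∷ oddsDesc-unique m

sum-filter-split : ∀ {p} {P : Pred ℕ p} (P? : Decidable P) xs →
  sum xs ≡ sum (filter P? xs) + sum (filter (¬? ∘ P?) xs)
sum-filter-split P? []       = refl
sum-filter-split P? (x ∷ xs) with does (P? x)
... | true  = trans (cong (x +_) (sum-filter-split P? xs)) (sym (+-assoc x _ _))
... | false = trans (cong (x +_) (sum-filter-split P? xs)) (x+[a+b]≡a+[x+b] x (sum (filter P? xs)) _)
  where
  x+[a+b]≡a+[x+b] : ∀ x a b → x + (a + b) ≡ a + (x + b)
  x+[a+b]≡a+[x+b] = solve-∀

delete : ∀ {x} Z → x ∈ Z →
  Σ (List ℕ) λ Z′ → sum Z ≡ x + sum Z′ × (∀ {y} → y ∈ Z → ¬ y ≡ x → y ∈ Z′)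
delete (z ∷ Z) (here refl) = Z , refl , λ { (here refl) y≢x → ⊥-elim (y≢x refl) ; (there y∈Z) _ → y∈Z }
delete {x} (z ∷ Z) (there x∈Z) with delete Z x∈Z
... | Z′ , sum≡ , keep = z ∷ Z′ , trans (cong (z +_) sum≡) (z+[x+s]≡x+[z+s] z x (sum Z′)) ,
  λ { (here refl) _ → here refl ; (there y∈Z) y≢x → there (keep y∈Z y≢x) }
  where
  z+[x+s]≡x+[z+s] : ∀ z x s → z + (x + s) ≡ x + (z + s)
  z+[x+s]≡x+[z+s] = solve-∀

sum-unique-⊆ : ∀ xs Z → Unique xs → All (_∈ Z) xs → sum xs ≤ sum Z
sum-unique-⊆ []       Z _             _           = z≤n
sum-unique-⊆ (x ∷ xs) Z (x∉xs ∷ uniq) (x∈Z ∷ xs⊆Z) with delete Z x∈Z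
... | Z′ , sum≡ , keep =
  ≤-trans (+-monoʳ-≤ x (sum-unique-⊆ xs Z′ uniq (still-in xs x∉xs xs⊆Z))) (≤-reflexive (sym sum≡))
  where
  still-in : ∀ ys → All (λ y → ¬ x ≡ y) ys → All (_∈ Z) ys → All (_∈ Z′) ys
  still-in []       _            _           = []
  still-in (y ∷ ys) (x≢y ∷ x≢ys) (y∈Z ∷ ys⊆Z) = keep y∈Z (x≢y ∘ sym) ∷ still-in ys x≢ys ys⊆Z

-- Every odd number below 2m lies in Y or (as a distinct element) in X′,
-- so m² ≤ ∑Y + ∑X′.
odd-square-bound : ∀ X → maxL X * maxL X ≤ sum (Yset X) + sum (X′ X)
odd-square-bound X = begin
    m * m                                              ≡⟨ sym (sum-odds m) ⟩
    sum (oddsDesc m)                                   ≡⟨ sum-filter-split (_∈? X′ X) (oddsDesc m) ⟩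
    sum (filter (_∈? X′ X) (oddsDesc m)) + sum (Yset X) ≤⟨ +-monoˡ-≤ (sum (Yset X)) in-X′ ⟩
    sum (X′ X) + sum (Yset X)                          ≡⟨ +-comm (sum (X′ X)) _ ⟩
    sum (Yset X) + sum (X′ X)                          ∎
  where
  open ≤-Reasoning
  m = maxL X
  in-X′ : sum (filter (_∈? X′ X) (oddsDesc m)) ≤ sum (X′ X)
  in-X′ = sum-unique-⊆ _ _ (filter⁺ (_∈? X′ X) (oddsDesc-unique m)) (all-filter (_∈? X′ X) (oddsDesc m))

sum-X′ : ∀ X → All (1 ≤_) X → sum (X′ X) + length X ≡ 2 * sum X
sum-X′ []      []         = refl
sum-X′ (a ∷ X) (1≤a ∷ ps) = begin
    (2 * a ∸ 1) + sum (X′ X) + suc (length X)   ≡⟨ regroup (2 * a ∸ 1) (sum (X′ X)) (length X) ⟩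
    (2 * a ∸ 1 + 1) + (sum (X′ X) + length X)   ≡⟨ cong₂ _+_ (m∸n+n≡m (≤-trans 1≤a (m≤m+n a (a + 0)))) (sum-X′ X ps) ⟩
    2 * a + 2 * sum X                           ≡⟨ sym (*-distribˡ-+ 2 a (sum X)) ⟩
    2 * (a + sum X)                             ∎
  where
  open ≡-Reasoning
  regroup : ∀ a b c → a + b + suc c ≡ (a + 1) + (b + c)
  regroup = solve-∀

sum-replicate : ∀ n c → sum (replicate n c) ≡ n * c
sum-replicate zero    c = refl
sum-replicate (suc n) c = cong (c +_) (sum-replicate n c)

sum-X′-fits : ∀ n B X → length X ≡ 3 * n → sum X ≡ n * B → All (1 ≤_) X →
  sum (X′ X) ≤ n * (2 * B ∸ 3)
sum-X′-fits n B X lenX sumX positive = +-cancelʳ-≤ (3 * n) _ _ (begin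
    sum (X′ X) + 3 * n        ≡⟨ cong (sum (X′ X) +_) (sym lenX) ⟩
    sum (X′ X) + length X     ≡⟨ sum-X′ X positive ⟩
    2 * sum X                 ≡⟨ cong (2 *_) sumX ⟩
    2 * (n * B)               ≡⟨ swap n B ⟩
    n * (2 * B)               ≤⟨ *-monoʳ-≤ n (m≤m∸n+n (2 * B) 3) ⟩
    n * (2 * B ∸ 3 + 3)       ≡⟨ distrib n (2 * B ∸ 3) ⟩
    n * (2 * B ∸ 3) + 3 * n   ∎)
  where
  open ≤-Reasoning
  swap : ∀ n B → 2 * (n * B) ≡ n * (2 * B)
  swap = solve-∀
  distrib : ∀ n c → n * (c + 3) ≡ n * c + 3 * n
  distrib = solve-∀
  m≤m∸n+n : ∀ x y → x ≤ x ∸ y + y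
  m≤m∸n+n x y = ≤-trans (m≤n+m∸n x y) (≤-reflexive (+-comm y (x ∸ y)))

-- |P_I| ≥ (2m+1)²: the T-blocks T_1,…,T_{m+1} give (2m+1)² - m² and the
-- Q-blocks at least m².
P_I-long : ∀ n B X → length X ≡ 3 * n → sum X ≡ n * B → All (1 ≤_) X →
  (2 * maxL X + 1) * (2 * maxL X + 1) ≤ pathLen (blocks n B X)
P_I-long n B X lenX sumX positive = begin
    L * L                                          ≡⟨ sym (sum-top-odds L (m + 1) m+1≤L) ⟩
    Ts + (L ∸ (m + 1)) * (L ∸ (m + 1))             ≡⟨ cong (λ k → Ts + k * k) L∸[m+1]≡m ⟩
    Ts + m * m                                     ≤⟨ +-monoʳ-≤ Ts (odd-square-bound X) ⟩
    Ts + (sum (Yset X) + sum (X′ X))               ≤⟨ +-monoʳ-≤ Ts (+-monoʳ-≤ (sum (Yset X)) (sum-X′-fits n B X lenX sumX positive)) ⟩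
    Ts + (sum (Yset X) + n * (2 * B ∸ 3))          ≡⟨ +-comm Ts _ ⟩
    sum (Yset X) + n * (2 * B ∸ 3) + Ts            ≡⟨ cong (_+ Ts) (trans (+-comm (sum (Yset X)) _) (sym Qsum)) ⟩
    sum (replicate n (2 * B ∸ 3) ++ Yset X) + Ts   ≤⟨ pathLen-blocks n B X ⟩
    pathLen (blocks n B X)                         ∎
  where
  open ≤-Reasoning
  m = maxL X
  L = 2 * m + 1
  Ts = sum (applyUpTo (λ t → tLen m (1 + t)) (m + 1))
  m+1≤L : m + 1 ≤ L
  m+1≤L = +-monoˡ-≤ 1 (m≤m+n m (m + 0))
  L∸[m+1]≡m : L ∸ (m + 1) ≡ m
  L∸[m+1]≡m = trans (cong (_∸ (m + 1)) (regroup m)) (m+n∸n≡m m (m + 1))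
    where
    regroup : ∀ m → 2 * m + 1 ≡ m + (m + 1)
    regroup = solve-∀
  Qsum : sum (replicate n (2 * B ∸ 3) ++ Yset X) ≡ n * (2 * B ∸ 3) + sum (Yset X)
  Qsum = trans (sum-++ (replicate n (2 * B ∸ 3)) _) (cong (_+ sum (Yset X)) (sum-replicate n _))

lemma4 : (n B : ℕ) (X : List ℕ) →
    Unique X → length X ≡ 3 * n → sum X ≡ n * B →
    All (λ a → B < 4 * a × 2 * a < B) X →
    (ys : Fin (2 * maxL X + 1) → Vtx (IG n B X)) →
    IsBurningSequence (IG n B X) (2 * maxL X + 1) ys →
    (i : Fin (2 * maxL X + 1)) → OnPI (ys i)
lemma4 n B X _ lenX sumX bounds ys burning =
  sources-on-path (blocks n B X) (2 * maxL X + 1) ys burning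
    (P_I-long n B X lenX sumX (all-map positive bounds))
  where
  positive : ∀ {a} → B < 4 * a × 2 * a < B → 1 ≤ a
  positive {zero}  (() , _)
  positive {suc a} _ = s≤s z≤n
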